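{- For the elementary cellular automaton $F_{28}$ and every nonempty finite word $u\in\{0,1\}^*$, $D(\textsc{SInv}_{F_{28},u,n})\in O(1)$ as $n\to\infty$.
   Context: The ECA with Wolfram number $N$ is $F_N:\{0,1\}^{\mathbb{Z}}\to\{0,1\}^{\mathbb{Z}}$, $(F_N(x))_i=f_N(x_{i-1},x_i,x_{i+1})$, where $f_N(a,b,c)$ is the bit of index $4a+2b+c$ of $N$ in binary. For a nonempty word $u$, $p_u\in\{0,1\}^{\mathbb{Z}}$ is $(p_u)_i=u_{i\bmod |u|}$; for a finite word $x$, $p_u[x]$ equals $x$ on positions $\{0,\dots,|x|-1\}$ and $p_u$ elsewhere. $\textsc{SInv}_{F,u,n}:\{0,1\}^n\to\{0,1\}$ maps $x$ to $1$ iff there is an integer $w$ such that for every $t\ge 0$ the set of positions where $F^t(p_u)$ and $F^t(p_u[x])$ differ is contained in an interval of length $w$. For finite sets $X,Y,Z$ and $g:X\times Y\to Z$, $D(g)$ is the minimal depth of a deterministic two-party communication protocol tree computing $g$ (Alice knows $x$, Bob knows $y$; internal nodes are labelled by a function of $x$ alone or of $y$ alone to $\{\mathrm{l},\mathrm{r}\}$, leaves by outputs). For $g:\{0,1\}^m\to Z$, $D(g)=\max_{0\le i\le m} D(g_i)$ with $g_i(x,y)=g(xy)$ for $x\in\{0,1\}^i$, $y\in\{0,1\}^{m-i}$. -}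

module Defs where

open import Data.Bool using (Bool; true; false; if_then_else_)
open import Data.Nat as ℕ using (ℕ; zero; suc; _≡ᵇ_; _<?_)
open import Data.Integer as ℤ using (ℤ; +_; -[1+_]; _%ℕ_; _≤_; _<_)
open import Data.Integer.DivMod using (n%ℕd<d)
open import Data.Fin using (Fin; fromℕ<)
open import Data.Vec using (Vec; lookup)
open import Data.Product using (Σ; ∃; _×_; _,_)
open import Relation.Nullary using (¬_; yes; no)
open import Relation.Binary.PropositionalEquality using (_≡_)

Config : Set
Config = ℤ → Bool

bitToℕ : Bool → ℕ
bitToℕ false = 0
bitToℕ true  = 1

bitAt : ℕ → ℕ → Bool
bitAt N zero    = (N ℕ.% 2) ≡ᵇ 1
bitAt N (suc k) = bitAt (N ℕ./ 2) k

localRule : ℕ → Bool → Bool → Bool → Bool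
localRule N a b c = bitAt N (4 ℕ.* bitToℕ a ℕ.+ 2 ℕ.* bitToℕ b ℕ.+ bitToℕ c)

ECA : ℕ → Config → Config
ECA N x i = localRule N (x (i ℤ.- + 1)) (x i) (x (i ℤ.+ + 1))

iterate : (Config → Config) → ℕ → Config → Config
iterate F zero    x = x
iterate F (suc t) x = F (iterate F t x)

periodic : ∀ {k} → Vec Bool (suc k) → Config
periodic {k} u i = lookup u (fromℕ< (n%ℕd<d i (suc k)))

patch : ∀ {k n} → Vec Bool (suc k) → Vec Bool n → Config
patch {n = n} u x (+ m) with m <? n
... | yes m<n = lookup x (fromℕ< m<n)
... | no  _   = periodic u (+ m)
patch u x -[1+ m ] = periodic u -[1+ m ]

-- SInv_{F,u,n}(x) = 1  iff  this predicate holds: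
-- there is w such that for every t the set of positions where F^t(p_u) and
-- F^t(p_u[x]) differ is contained in an interval {a, ..., a + w - 1} of length w.
SInv : (Config → Config) → ∀ {k} → Vec Bool (suc k) → ∀ {n} → Vec Bool n → Set
SInv F u x =
  ∃ λ (w : ℕ) → (t : ℕ) → ∃ λ (a : ℤ) → (i : ℤ) →
    ¬ (iterate F t (periodic u) i ≡ iterate F t (patch u x) i) →
    (a ≤ i) × (i < a ℤ.+ + w)

-- Deterministic two-party protocol trees (Alice knows x : X, Bob knows y : Y).
-- Internal nodes: a function of x alone (Alice) or of y alone (Bob) to {l,r}
-- (false = l, true = r); leaves are labelled by outputs.
data Protocol (X Y Z : Set) : Set where
  leaf  : Z → Protocol X Y Z
  alice : (X → Bool) → Protocol X Y Z → Protocol X Y Z → Protocol X Y Z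
  bob   : (Y → Bool) → Protocol X Y Z → Protocol X Y Z → Protocol X Y Z

run : ∀ {X Y Z} → Protocol X Y Z → X → Y → Z
run (leaf z)      x y = z
run (alice f l r) x y = if f x then run r x y else run l x y
run (bob g l r)   x y = if g y then run r x y else run l x y

depth : ∀ {X Y Z} → Protocol X Y Z → ℕ
depth (leaf _)      = 0
depth (alice _ l r) = suc (depth l ℕ.⊔ depth r)
depth (bob _ l r)   = suc (depth l ℕ.⊔ depth r)

Computes : ∀ {X Y} → Protocol X Y Bool → (X → Y → Set) → Set
Computes π P = ∀ x y → (run π x y ≡ true → P x y) × (P x y → run π x y ≡ true)

-- D(g) ≤ C for the {0,1}-valued g : {0,1}^n → {0,1} given by predicate P,
-- with n = i + j: for every split point i (0 ≤ i ≤ n), D(g_i) ≤ C.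
DBoundedBy : ℕ → (n : ℕ) → (∀ i j → i ℕ.+ j ≡ n → Vec Bool i → Vec Bool j → Set) → Set
DBoundedBy C n P = ∀ i j (e : i ℕ.+ j ≡ n) →
  Σ (Protocol (Vec Bool i) (Vec Bool j) Bool) λ π →
    (depth π ℕ.≤ C) × Computes π (P i j e)

-- Rule 28 sends a01 to 0 and 01c to 1, so a wall 01 never moves, and no information crosses
-- it: the cells from its 0 rightwards, and those up to its 1, evolve independently of the other
-- side. If u contains both letters, p_u has walls on both sides of any patch, so the discrepancy
-- is trapped between them and SInv is constantly 1. If u = 0^k and x contains a 1, then p_u[x]
-- has a wall (pinning a discrepancy at its 1) and a rightmost 1, which travels right at speed
-- one through the zeros; the discrepancy with the all-zero p_u therefore grows without bound.
-- If u = 1^k the same happens after one step, since 111 ↦ 0 turns p_u into zeros, while a 0 in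
-- x leaves a wall. So for u = b^k, SInv(xy) holds iff all letters of x and of y equal b, which
-- Alice and Bob check with two bits.
module Submission where

open import Defs
open import Data.Bool using (Bool; true; false; not)
import Data.Bool.Properties as Bool
open import Data.Empty using (⊥-elim)
open import Data.Fin as Fin using (toℕ)
open import Data.Nat using (ℕ; zero; suc)
open import Data.Product using (∃; ∃₂; _×_; _,_; proj₁; proj₂; uncurry)
open import Data.Sum using (_⊎_; inj₁; inj₂)
open import Data.Vec using (Vec; []; _∷_; _++_; lookup)
open import Data.Vec.Relation.Unary.All using (All; []; _∷_; all?)
open import Data.Vec.Relation.Unary.All.Properties using (lookup⁺; ++⁺; ++⁻)
open import Function using (_∘_; const; _⇔_; mk⇔; Equivalence)
open import Function.Construct.Composition using (_⇔-∘_)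
open import Relation.Nullary using (¬_; yes; no; does)
open import Relation.Unary using (Decidable)
open import Relation.Binary.PropositionalEquality

localRule-cong : ∀ N {a b c a′ b′ c′} → a ≡ a′ → b ≡ b′ → c ≡ c′ →
  localRule N a b c ≡ localRule N a′ b′ c′
localRule-cong N refl refl refl = refl

ECA-cong : ∀ N {x y} → x ≗ y → ECA N x ≗ ECA N y
ECA-cong N x≗y i = localRule-cong N (x≗y _) (x≗y _) (x≗y _)

module _ {F : Config → Config} where

  iterate-cong : (∀ {x y} → x ≗ y → F x ≗ F y) →
    ∀ {x y} → x ≗ y → ∀ t → iterate F t x ≗ iterate F t y
  iterate-cong F-cong x≗y zero    = x≗y
  iterate-cong F-cong x≗y (suc t) = F-cong (iterate-cong F-cong x≗y t)

  iterate-shift : ∀ t x → iterate F t (F x) ≡ iterate F (suc t) x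
  iterate-shift zero    x = refl
  iterate-shift (suc t) x = cong F (iterate-shift t x)

  iterate-invariant : (P : Config → Set) → (∀ {x} → P x → P (F x)) →
    ∀ {x} → P x → ∀ t → P (iterate F t x)
  iterate-invariant P step p zero    = p
  iterate-invariant P step p (suc t) = step (iterate-invariant P step p t)

  iterate-invariant₂ : (R : Config → Config → Set) → (∀ {x y} → R x y → R (F x) (F y)) →
    ∀ {x y} → R x y → ∀ t → R (iterate F t x) (iterate F t y)
  iterate-invariant₂ R step r zero    = r
  iterate-invariant₂ R step r (suc t) = step (iterate-invariant₂ R step r t)

different : ∀ {b c : Bool} → b ≡ false → c ≡ true → b ≢ c
different refl refl ()

all-or-counterexample : ∀ b {n} (z : Vec Bool n) → All (_≡ b) z ⊎ ∃ λ i → lookup z i ≡ not b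
all-or-counterexample b []      = inj₁ []
all-or-counterexample b (x ∷ z) with x Bool.≟ b | all-or-counterexample b z
... | yes x≡b | inj₁ z≡b      = inj₁ (x≡b ∷ z≡b)
... | yes _   | inj₂ (i , zᵢ) = inj₂ (Fin.suc i , zᵢ)
... | no x≢b  | _             = inj₂ (Fin.zero , Bool.¬-not x≢b)

constant-or-mixed : ∀ {k} (u : Vec Bool (suc k)) →
  (∃ λ b → All (_≡ b) u) ⊎ (∃₂ λ j₀ j₁ → lookup u j₀ ≡ false × lookup u j₁ ≡ true)
constant-or-mixed (x ∷ u) with all-or-counterexample x (x ∷ u)
constant-or-mixed (x     ∷ u) | inj₁ u≡x      = inj₁ (x , u≡x)
constant-or-mixed (false ∷ u) | inj₂ (j , u₁) = inj₂ (Fin.zero , j , refl , u₁)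
constant-or-mixed (true  ∷ u) | inj₂ (j , u₀) = inj₂ (j , Fin.zero , u₀ , refl)

module Rule28 where

  open import Data.Nat as ℕ using (_∸_; _*_; z≤n; s≤s)
  import Data.Nat.Properties as ℕₚ
  open import Data.Nat.DivMod using (_%_; [m+kn]%n≡m%n; m<n⇒m%n≡m; n%n≡0)
  open import Data.Integer using
    (ℤ; +_; -[1+_]; 0ℤ; 1ℤ; -_; ∣_∣; _+_; _-_; _≤_; _<_; _≟_; _≤?_; _%ℕ_; +≤+; -≤-; -≤+; +<+; -<+)
  open import Data.Integer.Properties using
    (≤-refl; ≤-reflexive; ≤-trans; <-trans; ≤-<-trans; <-≤-trans; <⇒≤; ≤⇒≯; ≰⇒>; ≤-total; ≤∧≢⇒<;
     ∣-∣-≤; +-comm; +-identityʳ; +-monoˡ-≤; i≤i+j; i-j≤i; suc[i]≤j⇒i<j; i<j⇒suc[i]≤j; i<j⇒i≤pred[j])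
  open import Data.Integer.Tactic.RingSolver using (solve-∀)
  import Data.Fin.Properties as Finₚ

  i+1-1≡i : ∀ i → i + 1ℤ - 1ℤ ≡ i
  i+1-1≡i = solve-∀

  i+[1+d]≡i+d+1 : ∀ i d → i + + suc d ≡ i + + d + 1ℤ
  i+[1+d]≡i+d+1 i d = lemma i (+ d)
    where
    lemma : ∀ i e → i + (1ℤ + e) ≡ i + e + 1ℤ
    lemma = solve-∀

  i+[1+d]≡i+1+d : ∀ i d → i + + suc d ≡ i + 1ℤ + + d
  i+[1+d]≡i+1+d i d = lemma i (+ d)
    where
    lemma : ∀ i e → i + (1ℤ + e) ≡ i + 1ℤ + e
    lemma = solve-∀

  i≤i+d : ∀ i d → i ≤ i + + d
  i≤i+d i d = i≤i+j i (+ d)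

  i<i+1 : ∀ i → i < i + 1ℤ
  i<i+1 i = suc[i]≤j⇒i<j (≤-reflexive (+-comm 1ℤ i))

  i<i+[1+d] : ∀ i d → i < i + + suc d
  i<i+[1+d] i d = <-≤-trans (i<i+1 i) (≤-trans (i≤i+d _ d) (≤-reflexive (sym (i+[1+d]≡i+1+d i d))))

  i<j⇒i+1≤j : ∀ {i j} → i < j → i + 1ℤ ≤ j
  i<j⇒i+1≤j {i} i<j = subst (_≤ _) (+-comm 1ℤ i) (i<j⇒suc[i]≤j i<j)

  i<j⇒i≤j-1 : ∀ {i j} → i < j → i ≤ j - 1ℤ
  i<j⇒i≤j-1 {j = j} i<j = subst (_ ≤_) (+-comm (- 1ℤ) j) (i<j⇒i≤pred[j] i<j)

  ≤⇒≡⊎< : ∀ {i j} → i ≤ j → i ≡ j ⊎ i < j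
  ≤⇒≡⊎< {i} {j} i≤j with i ≟ j
  ... | yes i≡j = inj₁ i≡j
  ... | no  i≢j = inj₂ (≤∧≢⇒< i≤j i≢j)

  ≤-offset : ∀ {i j} → i ≤ j → ∃ λ d → i + + d ≡ j
  ≤-offset {i} {j} i≤j = ∣ i - j ∣ , trans (cong (_+_ i) (∣-∣-≤ i≤j)) (i+[j-i]≡j i j)
    where
    i+[j-i]≡j : ∀ i j → i + (j - i) ≡ j
    i+[j-i]≡j = solve-∀

  BoundedDiscrepancy : (Config → Config) → Config → Config → Set
  BoundedDiscrepancy F x y = ∃ λ w → ∀ t → ∃ λ a → ∀ i →
    iterate F t x i ≢ iterate F t y i → a ≤ i × i < a + + w

  AgreeOn : (ℤ → Set) → Config → Config → Set
  AgreeOn P x y = ∀ i → P i → x i ≡ y i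

  ≗⇒boundedDiscrepancy : ∀ N {x y} → x ≗ y → BoundedDiscrepancy (ECA N) x y
  ≗⇒boundedDiscrepancy N x≗y =
    0 , λ t → 0ℤ , λ i xᵢ≢yᵢ → ⊥-elim (xᵢ≢yᵢ (iterate-cong (ECA-cong N) x≗y t i))

  boundedDiscrepancy-step : ∀ {F x y} → BoundedDiscrepancy F x y → BoundedDiscrepancy F (F x) (F y)
  boundedDiscrepancy-step {F} {x} {y} (w , window) = w , λ t → step t (window (suc t))
    where
    step : ∀ t → (∃ λ a → ∀ i → iterate F (suc t) x i ≢ iterate F (suc t) y i → a ≤ i × i < a + + w) →
      ∃ λ a → ∀ i → iterate F t (F x) i ≢ iterate F t (F y) i → a ≤ i × i < a + + w
    step t (a , inside) = a , λ i xᵢ≢yᵢ → inside i λ xᵢ≡yᵢ → xᵢ≢yᵢ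
      (trans (cong-app (iterate-shift t x) i) (trans xᵢ≡yᵢ (sym (cong-app (iterate-shift t y) i))))

  agreeOutside⇒boundedDiscrepancy : ∀ {F x y l r} → l ≤ r →
    (∀ t → AgreeOn (_≤ l) (iterate F t x) (iterate F t y)) →
    (∀ t → AgreeOn (r ≤_) (iterate F t x) (iterate F t y)) → BoundedDiscrepancy F x y
  agreeOutside⇒boundedDiscrepancy {F} {x} {y} {l} l≤r left right with ≤-offset l≤r
  ... | d , refl = d , λ t → l , window t
    where
    window : ∀ t i → iterate F t x i ≢ iterate F t y i → l ≤ i × i < l + + d
    window t i differ with i ≤? l | l + + d ≤? i
    ... | yes i≤l | _       = ⊥-elim (differ (left t i i≤l))
    ... | _       | yes r≤i = ⊥-elim (differ (right t i r≤i))
    ... | no i≰l  | no r≰i  = <⇒≤ (≰⇒> i≰l) , ≰⇒> r≰i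

  periodic-constant : ∀ {k b} {u : Vec Bool (suc k)} → All (_≡ b) u → periodic u ≗ const b
  periodic-constant u≡b i = lookup⁺ u≡b _

  module _ {k} (u : Vec Bool (suc k)) where

    periodic-at : ∀ i j → i %ℕ suc k ≡ toℕ j → periodic u i ≡ lookup u j
    periodic-at i j i%m≡j =
      cong (lookup u) (trans (Finₚ.fromℕ<-cong _ _ i%m≡j _ (Finₚ.toℕ<n j)) (Finₚ.fromℕ<-toℕ j _))

    periodic-+ : ∀ j c → periodic u (+ (toℕ j ℕ.+ c * suc k)) ≡ lookup u j
    periodic-+ j c = periodic-at (+ (toℕ j ℕ.+ c * suc k)) j
      (trans ([m+kn]%n≡m%n (toℕ j) c (suc k)) (m<n⇒m%n≡m (Finₚ.toℕ<n j)))

    -- -[1+ N ] %ℕ m is m ∸ (suc N % m), except that it is 0 when m divides suc N.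
    periodic-- : ∀ j c → periodic u -[1+ (k ∸ toℕ j ℕ.+ c * suc k) ] ≡ lookup u j
    periodic-- j c = periodic-at -[1+ (k ∸ toℕ j ℕ.+ c * suc k) ] j (trans (-[1+N]%ℕm _)
      (trans (cong reflect ([m+kn]%n≡m%n (suc (k ∸ toℕ j)) c (suc k))) (reflect-[1+k-j] j)))
      where
      reflect : ℕ → ℕ
      reflect zero    = zero
      reflect (suc r) = suc k ∸ suc r
      -[1+N]%ℕm : ∀ N → -[1+ N ] %ℕ suc k ≡ reflect (suc N % suc k)
      -[1+N]%ℕm N with suc N % suc k
      ... | zero  = refl
      ... | suc _ = refl
      reflect-[1+k-j] : ∀ j → reflect (suc (k ∸ toℕ j) % suc k) ≡ toℕ j
      reflect-[1+k-j] Fin.zero    = cong reflect (n%n≡0 (suc k))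
      reflect-[1+k-j] (Fin.suc j) =
        trans (cong reflect (m<n⇒m%n≡m (s≤s 1+k-[1+j]≤k))) (ℕₚ.m∸[m∸n]≡n 1+j≤k)
        where
        1+j≤k : suc (toℕ j) ℕ.≤ k
        1+j≤k = ℕₚ.≤-pred (Finₚ.toℕ<n (Fin.suc j))
        1+k-[1+j]≤k : suc (k ∸ suc (toℕ j)) ℕ.≤ k
        1+k-[1+j]≤k = ℕₚ.≤-trans (ℕₚ.≤-reflexive (sym (ℕₚ.+-∸-assoc 1 1+j≤k))) (ℕₚ.m∸n≤m k (toℕ j))

  module _ {k n} (u : Vec Bool (suc k)) (z : Vec Bool n) where

    patch-lookup : ∀ i → patch u z (+ toℕ i) ≡ lookup z i
    patch-lookup i with toℕ i ℕ.<? n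
    ... | yes i<n = cong (lookup z) (Finₚ.fromℕ<-toℕ i i<n)
    ... | no  i≮n = ⊥-elim (i≮n (Finₚ.toℕ<n i))

    patch-beyond : ∀ {j} → + n ≤ j → patch u z j ≡ periodic u j
    patch-beyond {+ m} (+≤+ n≤m) with m ℕ.<? n
    ... | yes m<n = ⊥-elim (ℕₚ.<⇒≱ m<n n≤m)
    ... | no  _   = refl

    patch-negative : ∀ {i} → i < 0ℤ → periodic u i ≡ patch u z i
    patch-negative { -[1+ m ]} _ = refl
    patch-negative {+ m} (+<+ ())

    patch-constant : ∀ {b} → All (_≡ b) u → All (_≡ b) z → patch u z ≗ const b
    patch-constant u≡b z≡b (+ m) with m ℕ.<? n
    ... | yes _ = lookup⁺ z≡b _
    ... | no  _ = lookup⁺ u≡b _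
    patch-constant u≡b z≡b -[1+ m ] = lookup⁺ u≡b _

  -- Rule 28: walls and the rightmost one

  F₂₈ : Config → Config
  F₂₈ = ECA 28

  f₂₈[·01]≡0 : ∀ a → localRule 28 a false true ≡ false
  f₂₈[·01]≡0 false = refl
  f₂₈[·01]≡0 true  = refl

  f₂₈[01·]≡1 : ∀ c → localRule 28 false true c ≡ true
  f₂₈[01·]≡1 false = refl
  f₂₈[01·]≡1 true  = refl

  F₂₈-local : ∀ x i {a b c} → x (i - 1ℤ) ≡ a → x i ≡ b → x (i + 1ℤ) ≡ c →
    F₂₈ x i ≡ localRule 28 a b c
  F₂₈-local x i = localRule-cong 28

  F₂₈-cong-at : ∀ x y i → x (i - 1ℤ) ≡ y (i - 1ℤ) → x i ≡ y i → x (i + 1ℤ) ≡ y (i + 1ℤ) →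
    F₂₈ x i ≡ F₂₈ y i
  F₂₈-cong-at x y i = localRule-cong 28

  iterate-false : ∀ {x} → x ≗ const false → ∀ t → iterate F₂₈ t x ≗ const false
  iterate-false = iterate-invariant (_≗ const false) (ECA-cong 28)

  record Wall (x : Config) (s : ℤ) : Set where
    constructor wall
    field
      zero-at  : x s ≡ false
      one-next : x (s + 1ℤ) ≡ true

  wall-step : ∀ {x s} → Wall x s → Wall (F₂₈ x) s
  wall-step {x} {s} (wall xₛ xₛ₊₁) = wall
    (trans (F₂₈-local x s refl xₛ xₛ₊₁) (f₂₈[·01]≡0 (x (s - 1ℤ))))
    (trans (F₂₈-local x (s + 1ℤ) (trans (cong x (i+1-1≡i s)) xₛ) xₛ₊₁ refl)
           (f₂₈[01·]≡1 (x (s + 1ℤ + 1ℤ))))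

  wall-iterate : ∀ {x s} → Wall x s → ∀ t → Wall (iterate F₂₈ t x) s
  wall-iterate {s = s} = iterate-invariant (λ x → Wall x s) wall-step

  wall-within : ∀ x a d → x a ≡ false → x (a + + d) ≡ true →
    ∃ λ s → a ≤ s × s < a + + d × Wall x s
  wall-within x a zero    xₐ xₐ₊₀ =
    ⊥-elim (different xₐ (subst (λ i → x i ≡ true) (+-identityʳ a) xₐ₊₀) refl)
  wall-within x a (suc d) xₐ xₐ₊ₛ with x (a + 1ℤ) in xₐ₊₁
  ... | true  = a , ≤-refl , i<i+[1+d] a d , wall xₐ xₐ₊₁
  ... | false with wall-within x (a + 1ℤ) d xₐ₊₁ (subst (λ i → x i ≡ true) (i+[1+d]≡i+1+d a d) xₐ₊ₛ)
  ...   | s , a+1≤s , s<a+1+d , wallₛ =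
          s , ≤-trans (<⇒≤ (i<i+1 a)) a+1≤s , subst (s <_) (sym (i+[1+d]≡i+1+d a d)) s<a+1+d , wallₛ

  wall-between : ∀ x {a b} → a ≤ b → x a ≡ false → x b ≡ true → ∃ λ s → a ≤ s × s < b × Wall x s
  wall-between x {a} a≤b xₐ x_b with ≤-offset a≤b
  ... | d , refl = wall-within x a d xₐ x_b

  record RightmostOne (x : Config) (q : ℤ) : Set where
    constructor rightmostOne
    field
      one-at      : x q ≡ true
      zeros-after : ∀ j → q < j → x j ≡ false

  rightmostOne-step : ∀ {x q} → RightmostOne x q → RightmostOne (F₂₈ x) (q + 1ℤ)
  rightmostOne-step {x} {q} (rightmostOne x_q after) = rightmostOne
    (F₂₈-local x (q + 1ℤ) (trans (cong x (i+1-1≡i q)) x_q) (after _ (i<i+1 q)) (after _ q<q+1+1))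
    λ j q+1<j → F₂₈-local x j (after _ (q<j-1 q+1<j)) (after _ (<-trans (i<i+1 q) q+1<j))
                              (after _ (<-trans (<-trans (i<i+1 q) q+1<j) (i<i+1 j)))
    where
    q<q+1+1 : q < q + 1ℤ + 1ℤ
    q<q+1+1 = <-trans (i<i+1 q) (i<i+1 (q + 1ℤ))
    q<j-1 : ∀ {j} → q + 1ℤ < j → q < j - 1ℤ
    q<j-1 q+1<j = <-≤-trans (i<i+1 q) (i<j⇒i≤j-1 q+1<j)

  rightmostOne-iterate : ∀ {x q} → RightmostOne x q → ∀ t → RightmostOne (iterate F₂₈ t x) (q + + t)
  rightmostOne-iterate {x} {q} r zero    = subst (RightmostOne x) (sym (+-identityʳ q)) r
  rightmostOne-iterate {x} {q} r (suc t) =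
    subst (RightmostOne _) (sym (i+[1+d]≡i+d+1 q t)) (rightmostOne-step (rightmostOne-iterate r t))

  rightmostOne-within : ∀ x p d → x p ≡ true → (∀ j → p + + d ≤ j → x j ≡ false) →
    ∃ λ q → p ≤ q × RightmostOne x q
  rightmostOne-within x p zero    xₚ after =
    ⊥-elim (different (after p (≤-reflexive (+-identityʳ p))) xₚ refl)
  rightmostOne-within x p (suc d) xₚ after with x (p + + d) in xₚ₊d
  ... | true  = p + + d , i≤i+d p d , rightmostOne xₚ₊d λ j p+d<j → after j (p+[1+d]≤ p+d<j)
    where
    p+[1+d]≤ : ∀ {j} → p + + d < j → p + + suc d ≤ j
    p+[1+d]≤ {j} p+d<j = subst (_≤ j) (sym (i+[1+d]≡i+d+1 p d)) (i<j⇒i+1≤j p+d<j)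
  ... | false = rightmostOne-within x p d xₚ after′
    where
    after′ : ∀ j → p + + d ≤ j → x j ≡ false
    after′ j p+d≤j with ≤⇒≡⊎< p+d≤j
    ... | inj₁ refl  = xₚ₊d
    ... | inj₂ p+d<j = after j (subst (_≤ j) (sym (i+[1+d]≡i+d+1 p d)) (i<j⇒i+1≤j p+d<j))

  rightmostOne-after : ∀ x {p M} → x p ≡ true → (∀ j → M ≤ j → x j ≡ false) →
    ∃ λ q → p ≤ q × RightmostOne x q
  rightmostOne-after x {p} {M} xₚ after with ≤-total p M
  ... | inj₂ M≤p = ⊥-elim (different (after p M≤p) xₚ refl)
  ... | inj₁ p≤M with ≤-offset p≤M
  ...   | d , refl = rightmostOne-within x p d xₚ after

  wall⇒¬boundedDiscrepancy : ∀ {x y s M} → x ≗ const false → Wall y s → (∀ j → M ≤ j → y j ≡ false) →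
    ¬ BoundedDiscrepancy F₂₈ x y
  wall⇒¬boundedDiscrepancy {x} {y} {s} x≡0 wallₛ zeros (w , window)
    with rightmostOne-after y (Wall.one-next wallₛ) zeros | window w
  ... | q , s+1≤q , rightmost | a , inside = ≤⇒≯ (+-monoˡ-≤ (+ w) a≤q) q+w<a+w
    where
    a≤q : a ≤ q
    a≤q = ≤-trans (proj₁ (inside (s + 1ℤ)
      (different (iterate-false x≡0 w _) (Wall.one-next (wall-iterate wallₛ w))))) s+1≤q
    q+w<a+w : q + + w < a + + w
    q+w<a+w = proj₂ (inside (q + + w)
      (different (iterate-false x≡0 w _) (RightmostOne.one-at (rightmostOne-iterate rightmost w))))

  agree-right-step : ∀ {x y s} → Wall x s → AgreeOn (s ≤_) x y → AgreeOn (s ≤_) (F₂₈ x) (F₂₈ y)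
  agree-right-step {x} {y} {s} wallₛ agree i s≤i with ≤⇒≡⊎< s≤i
  ... | inj₁ refl = trans (Wall.zero-at (wall-step wallₛ)) (sym (Wall.zero-at (wall-step wall-y)))
    where
    wall-y : Wall y s
    wall-y = wall (trans (sym (agree s ≤-refl)) (Wall.zero-at wallₛ))
                  (trans (sym (agree _ (<⇒≤ (i<i+1 s)))) (Wall.one-next wallₛ))
  ... | inj₂ s<i = F₂₈-cong-at x y i
    (agree _ (i<j⇒i≤j-1 s<i)) (agree i s≤i) (agree _ (<⇒≤ (<-trans s<i (i<i+1 i))))

  agree-left-step : ∀ {x y s} → Wall x s → AgreeOn (_≤ s + 1ℤ) x y → AgreeOn (_≤ s + 1ℤ) (F₂₈ x) (F₂₈ y)
  agree-left-step {x} {y} {s} wallₛ agree i i≤s+1 with ≤⇒≡⊎< i≤s+1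
  ... | inj₁ refl = trans (Wall.one-next (wall-step wallₛ)) (sym (Wall.one-next (wall-step wall-y)))
    where
    wall-y : Wall y s
    wall-y = wall (trans (sym (agree s (<⇒≤ (i<i+1 s)))) (Wall.zero-at wallₛ))
                  (trans (sym (agree _ ≤-refl)) (Wall.one-next wallₛ))
  ... | inj₂ i<s+1 = F₂₈-cong-at x y i
    (agree _ (≤-trans (i-j≤i i 1ℤ) i≤s+1)) (agree i i≤s+1) (agree _ (i<j⇒i+1≤j i<s+1))

  agree-right-iterate : ∀ {x y s} → Wall x s → AgreeOn (s ≤_) x y →
    ∀ t → AgreeOn (s ≤_) (iterate F₂₈ t x) (iterate F₂₈ t y)
  agree-right-iterate {s = s} wallₛ agree t =
    proj₂ (iterate-invariant₂ (λ x y → Wall x s × AgreeOn (s ≤_) x y)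
      (λ (wallₛ , agree) → wall-step wallₛ , agree-right-step wallₛ agree) (wallₛ , agree) t)

  agree-left-iterate : ∀ {x y s} → Wall x s → AgreeOn (_≤ s + 1ℤ) x y →
    ∀ t → AgreeOn (_≤ s + 1ℤ) (iterate F₂₈ t x) (iterate F₂₈ t y)
  agree-left-iterate {s = s} wallₛ agree t =
    proj₂ (iterate-invariant₂ (λ x y → Wall x s × AgreeOn (_≤ s + 1ℤ) x y)
      (λ (wallₛ , agree) → wall-step wallₛ , agree-left-step wallₛ agree) (wallₛ , agree) t)

  -- Constant words

  module _ {k n} (u : Vec Bool (suc k)) (z : Vec Bool n) where

    ¬SInv₂₈-zeros : All (_≡ false) u → ∀ i → lookup z i ≡ true → ¬ SInv F₂₈ u z
    ¬SInv₂₈-zeros u≡0 i zᵢ =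
      let _ , _ , _ , wallₛ = wall-between (patch u z) { -[1+ 0 ]} -≤+
                                (periodic-constant u≡0 -[1+ 0 ]) (trans (patch-lookup u z i) zᵢ)
      in wall⇒¬boundedDiscrepancy (periodic-constant u≡0) wallₛ
           (λ j n≤j → trans (patch-beyond u z n≤j) (periodic-constant u≡0 j))

    ¬SInv₂₈-ones : All (_≡ true) u → ∀ i → lookup z i ≡ false → ¬ SInv F₂₈ u z
    ¬SInv₂₈-ones u≡1 i zᵢ =
      let _ , _ , _ , wallₛ = wall-between (patch u z) (+≤+ (ℕₚ.<⇒≤ (Finₚ.toℕ<n i)))
                                (trans (patch-lookup u z i) zᵢ) (one-beyond ℕₚ.≤-refl)
      in wall⇒¬boundedDiscrepancy (ECA-cong 28 (periodic-constant u≡1)) (wall-step wallₛ) zeros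
           ∘ boundedDiscrepancy-step
      where
      one-beyond : ∀ {m} → n ℕ.≤ m → patch u z (+ m) ≡ true
      one-beyond {m} n≤m = trans (patch-beyond u z (+≤+ n≤m)) (periodic-constant u≡1 (+ m))
      zeros : ∀ j → + suc n ≤ j → F₂₈ (patch u z) j ≡ false
      zeros (+ suc m) (+≤+ (s≤s n≤m)) = F₂₈-local (patch u z) (+ suc m) (one-beyond n≤m)
        (one-beyond (ℕₚ.m≤n⇒m≤1+n n≤m)) (one-beyond (ℕₚ.m≤n⇒m≤1+n (ℕₚ.m≤n⇒m≤n+o 1 n≤m)))

  SInv₂₈-constant : ∀ {k n b} {u : Vec Bool (suc k)} {z : Vec Bool n} → All (_≡ b) u →
    All (_≡ b) z ⇔ SInv F₂₈ u z
  SInv₂₈-constant {b = b} {u} {z} u≡b = mk⇔ from to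
    where
    from : All (_≡ b) z → SInv F₂₈ u z
    from z≡b = ≗⇒boundedDiscrepancy 28 λ i →
      trans (periodic-constant u≡b i) (sym (patch-constant u z u≡b z≡b i))
    ¬SInv₂₈ : ∀ b → All (_≡ b) u → ∀ i → lookup z i ≡ not b → ¬ SInv F₂₈ u z
    ¬SInv₂₈ false = ¬SInv₂₈-zeros u z
    ¬SInv₂₈ true  = ¬SInv₂₈-ones u z
    to : SInv F₂₈ u z → All (_≡ b) z
    to sinv with all-or-counterexample b z
    ... | inj₁ z≡b      = z≡b
    ... | inj₂ (i , zᵢ) = ⊥-elim (¬SInv₂₈ b u≡b i zᵢ sinv)

  -- Words containing both letters

  module _ {k} (u : Vec Bool (suc k)) {j₀ j₁} (u₀ : lookup u j₀ ≡ false) (u₁ : lookup u j₁ ≡ true) where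

    periodic-wall-right-of : ∀ n → ∃ λ s → + n ≤ s × Wall (periodic u) s
    periodic-wall-right-of n =
      let s , a≤s , _ , wallₛ = wall-between (periodic u) (+≤+ a≤b)
                                  (trans (periodic-+ u j₀ n) u₀) (trans (periodic-+ u j₁ (suc n)) u₁)
      in s , ≤-trans (+≤+ n≤a) a≤s , wallₛ
      where
      n≤a : n ℕ.≤ toℕ j₀ ℕ.+ n * suc k
      n≤a = ℕₚ.≤-trans (ℕₚ.m≤m*n n (suc k)) (ℕₚ.m≤n+m _ (toℕ j₀))
      a≤b : toℕ j₀ ℕ.+ n * suc k ℕ.≤ toℕ j₁ ℕ.+ suc n * suc k
      a≤b = ℕₚ.≤-trans (ℕₚ.+-monoˡ-≤ (n * suc k) (ℕₚ.<⇒≤ (Finₚ.toℕ<n j₀))) (ℕₚ.m≤n+m _ (toℕ j₁))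

    periodic-wall-left-of-0 : ∃ λ s → s + 1ℤ < 0ℤ × Wall (periodic u) s
    periodic-wall-left-of-0 =
      let s , _ , s<b , wallₛ = wall-between (periodic u) (-≤- b≤a)
                                  (trans (periodic-- u j₀ 1) u₀) (trans (periodic-- u j₁ 0) u₁)
      in s , ≤-<-trans (i<j⇒i+1≤j s<b) -<+ , wallₛ
      where
      b≤a : k ∸ toℕ j₁ ℕ.+ 0 ℕ.≤ k ∸ toℕ j₀ ℕ.+ 1 * suc k
      b≤a = ℕₚ.≤-trans (ℕₚ.+-monoˡ-≤ 0 (ℕₚ.m∸n≤m k (toℕ j₁)))
                       (ℕₚ.≤-trans (ℕₚ.n≤1+n (k ℕ.+ 0)) (ℕₚ.m≤n+m _ _))

    SInv₂₈-mixed : ∀ {n} (z : Vec Bool n) → SInv F₂₈ u z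
    SInv₂₈-mixed {n} z =
      let r , n≤r , wallᵣ = periodic-wall-right-of n
          l , l+1<0 , wallₗ = periodic-wall-left-of-0
      in agreeOutside⇒boundedDiscrepancy (<⇒≤ (<-≤-trans l+1<0 (≤-trans (+≤+ z≤n) n≤r)))
           (agree-left-iterate wallₗ λ i i≤l+1 → patch-negative u z (≤-<-trans i≤l+1 l+1<0))
           (agree-right-iterate wallᵣ λ i r≤i → sym (patch-beyond u z (≤-trans n≤r r≤i)))

open Rule28 using (SInv₂₈-constant; SInv₂₈-mixed)

open import Data.Nat using (_≤_; z≤n)
open import Data.Nat.Properties using (≤-refl)

conjunction : ∀ {X Y : Set} {P : X → Set} {Q : Y → Set} → Decidable P → Decidable Q → Protocol X Y Bool
conjunction P? Q? = alice (does ∘ P?) (leaf false) (bob (does ∘ Q?) (leaf false) (leaf true))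

conjunction-computes : ∀ {X Y : Set} {P : X → Set} {Q : Y → Set} (P? : Decidable P) (Q? : Decidable Q) →
  Computes (conjunction P? Q?) (λ x y → P x × Q y)
conjunction-computes P? Q? x y with P? x | Q? y
... | yes p | yes q = (λ _ → p , q) , λ _ → refl
... | yes _ | no ¬q = (λ ()) , λ (_ , q) → ⊥-elim (¬q q)
... | no ¬p | _     = (λ ()) , λ (p , _) → ⊥-elim (¬p p)

Computes-⇔ : ∀ {X Y : Set} {π : Protocol X Y Bool} {P Q : X → Y → Set} →
  (∀ x y → P x y ⇔ Q x y) → Computes π P → Computes π Q
Computes-⇔ P⇔Q π-computes x y =
  let to , from = π-computes x y in Equivalence.to (P⇔Q x y) ∘ to , from ∘ Equivalence.from (P⇔Q x y)

++⇔ : ∀ {A : Set} {P : A → Set} {i j} (x : Vec A i) {y : Vec A j} → (All P x × All P y) ⇔ All P (x ++ y)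
++⇔ x = mk⇔ (uncurry ++⁺) (++⁻ x)

proposition7 : ∀ {k} (u : Vec Bool (suc k)) →
    ∃ λ (C : ℕ) → ∃ λ (N : ℕ) → (n : ℕ) → N ≤ n →
      DBoundedBy C n (λ i j _ x y → SInv (ECA 28) u (x ++ y))
proposition7 u with constant-or-mixed u
... | inj₁ (b , u≡b) = 2 , 0 , λ _ _ _ _ _ →
  conjunction all-b? all-b? , ≤-refl ,
  Computes-⇔ {π = conjunction all-b? all-b?} (λ x y → SInv₂₈-constant u≡b ⇔-∘ ++⇔ x)
    (conjunction-computes all-b? all-b?)
  where
  all-b? : ∀ {m} → Decidable (All (_≡ b) {m})
  all-b? = all? (Bool._≟ b)
... | inj₂ (_ , _ , u₀ , u₁) = 0 , 0 , λ _ _ _ _ _ →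
  leaf true , z≤n , λ x y → (λ _ → SInv₂₈-mixed u u₀ u₁ (x ++ y)) , λ _ → refl
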